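{- If $\Gamma$ is a $(\delta_1,\delta_2)$-semiregular bipartite simple graph, then $$a({\cal L}(\Gamma))=\left\lceil\frac{\delta_1+\delta_2-1}{2}\right\rceil\quad\text{and}\quad \hat a({\cal L}(\Gamma))=\left\lceil\frac{\delta_1+\delta_2}{2}\right\rceil,$$ where ${\cal L}(\Gamma)$ is the line graph of $\Gamma$.
   Context: A $(\delta_1,\delta_2)$-semiregular bipartite graph is a bipartite graph with bipartition $(X,Y)$ in which every vertex of $X$ has degree $\delta_1$ and every vertex of $Y$ has degree $\delta_2$. For a graph $G=(V,E)$, a set $S\subseteq V$ and a vertex $v$, let $N_S(v)$ be the set of neighbours of $v$ in $S$ and $N_{V\setminus S}(v)$ the set of neighbours of $v$ in $V\setminus S$. A nonempty set $S\subseteq V$ is a defensive alliance if $|N_S(v)|+1\ge |N_{V\setminus S}(v)|$ for every $v\in S$, and a strong defensive alliance if $|N_S(v)|\ge|N_{V\setminus S}(v)|$ for every $v\in S$. The defensive alliance number $a(G)$ (resp. strong defensive alliance number $\hat a(G)$) is the minimum cardinality of a defensive alliance (resp. strong defensive alliance) in $G$. The line graph ${\cal L}(\Gamma)$ has the edges of $\Gamma$ as vertices, two being adjacent when they share an endpoint. -}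

module Defs where

open import Data.Bool using (Bool; true; false; _∧_; _∨_; not; T)
open import Data.Nat using (ℕ; zero; suc; _+_; _≤_; _≥_; _<_)
open import Data.Fin using (Fin)
open import Data.Fin.Properties using (_≟_; _<?_)
open import Data.List using (List; []; _∷_; allFin; cartesianProduct; filterᵇ)
open import Data.List.Membership.Propositional using (_∈_)
open import Data.Product using (_×_; _,_; Σ; ∃)
open import Relation.Nullary.Decidable using (⌊_⌋)
open import Relation.Binary.PropositionalEquality using (_≡_; _≢_)

count : {A : Set} → (A → Bool) → List A → ℕ
count p []       = 0
count p (x ∷ xs) with p x
... | true  = suc (count p xs)
... | false = count p xs

module Alliance {V : Set} (verts : List V) (adj : V → V → Bool) where

  card : (V → Bool) → ℕ
  card S = count S verts

  degIn : (V → Bool) → V → ℕ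
  degIn S v = count (λ u → adj v u ∧ S u) verts

  degOut : (V → Bool) → V → ℕ
  degOut S v = count (λ u → adj v u ∧ not (S u)) verts

  NonemptySubset : (V → Bool) → Set
  NonemptySubset S = (∀ v → T (S v) → v ∈ verts) × (∃ λ v → v ∈ verts × T (S v))

  IsDefensiveAlliance : (V → Bool) → Set
  IsDefensiveAlliance S =
    NonemptySubset S × (∀ v → v ∈ verts → T (S v) → degOut S v ≤ suc (degIn S v))

  IsStrongDefensiveAlliance : (V → Bool) → Set
  IsStrongDefensiveAlliance S =
    NonemptySubset S × (∀ v → v ∈ verts → T (S v) → degOut S v ≤ degIn S v)

  IsMinCard : ((V → Bool) → Set) → ℕ → Set
  IsMinCard P k = (Σ (V → Bool) λ S → P S × card S ≡ k)
                × (∀ S → P S → k ≤ card S)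

  AllianceNumber≡ : ℕ → Set
  AllianceNumber≡ = IsMinCard IsDefensiveAlliance

  StrongAllianceNumber≡ : ℕ → Set
  StrongAllianceNumber≡ = IsMinCard IsStrongDefensiveAlliance

record SimpleGraph (n : ℕ) : Set where
  field
    adj     : Fin n → Fin n → Bool
    symm    : ∀ i j → adj i j ≡ adj j i
    irrefl  : ∀ i → adj i i ≡ false

degree : ∀ {n} → SimpleGraph n → Fin n → ℕ
degree {n} G v = count (SimpleGraph.adj G v) (allFin n)

record IsSemiregularBipartite {n : ℕ} (G : SimpleGraph n) (δ₁ δ₂ : ℕ) : Set where
  field
    side      : Fin n → Bool
    bipartite : ∀ i j → T (SimpleGraph.adj G i j) → side i ≢ side j
    degX      : ∀ v → side v ≡ false → degree G v ≡ δ₁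
    degY      : ∀ v → side v ≡ true  → degree G v ≡ δ₂

-- Line graph: vertices are the edges {i,j} of G, each represented
-- once as the pair (i , j) with i < j; two edges are adjacent iff they
-- are distinct and share an endpoint.

module _ {n : ℕ} (G : SimpleGraph n) where
  open SimpleGraph G

  lineVerts : List (Fin n × Fin n)
  lineVerts = filterᵇ (λ { (i , j) → ⌊ i <? j ⌋ ∧ adj i j })
                      (cartesianProduct (allFin n) (allFin n))

  _==_ : Fin n → Fin n → Bool
  i == j = ⌊ i ≟ j ⌋

  lineAdj : Fin n × Fin n → Fin n × Fin n → Bool
  lineAdj (i , j) (k , l) =
    not ((i == k) ∧ (j == l))
    ∧ ((i == k) ∨ (i == l) ∨ (j == k) ∨ (j == l))

-- Every edge ij of Γ is adjacent in L(Γ) to the deg i + deg j - 2 other edges at its two ends, and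
-- deg i + deg j = δ₁ + δ₂ because i and j lie on opposite sides; so L(Γ) is d-regular with
-- d = δ₁ + δ₂ - 2.  A member v of an alliance S has at most |S| - 1 neighbours inside S and the other
-- d - |N_S(v)| outside, so |N_{V∖S}(v)| ≤ |N_S(v)| + t (t = 1 defensive, t = 0 strong) forces
-- 2|S| ≥ d + 2 - t.  Conversely, the edges at a vertex of degree max(δ₁, δ₂) ≥ (δ₁ + δ₂)/2 are
-- pairwise adjacent in L(Γ), and any ⌈(d + 2 - t)/2⌉ of them already form such an alliance.
module Submission where

open import Defs
open import Data.Bool using (Bool; true; false; _∧_; _∨_; not; T)
open import Data.Bool.Properties using (T-∧; T-∨; ∨-assoc; ∧-comm; ∧-zeroʳ; ∨-identityʳ)
open import Data.Empty using (⊥; ⊥-elim)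
open import Data.Fin as F using (Fin)
open import Data.Fin.Properties as FP using (_≟_; _<?_)
open import Data.List using (List; []; _∷_; filterᵇ; cartesianProduct; map; _++_; allFin)
open import Data.List.Membership.Propositional using (_∈_)
open import Data.List.Membership.Propositional.Properties using (∈-filter⁻; ∈-allFin)
import Data.List.Relation.Unary.All as All
open import Data.List.Relation.Unary.Any using (here; there)
open import Data.List.Relation.Unary.Unique.Propositional using (Unique; []; _∷_)
open import Data.List.Relation.Unary.Unique.Propositional.Properties using (filter⁺; cartesianProduct⁺; allFin⁺)
open import Data.Nat using (ℕ; zero; suc; _+_; _*_; _∸_; _≤_; _<_; _≥_; z≤n; s≤s; ⌊_/2⌋; ⌈_/2⌉)
open import Data.Nat.Properties hiding (_≟_; _<?_)
open import Data.Nat.Tactic.RingSolver using (solve-∀)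
open import Data.Product using (Σ-syntax; ∃-syntax; _×_; _,_; proj₁; proj₂)
open import Data.Product.Properties using (≡-dec)
open import Data.Sum using (_⊎_; inj₁; inj₂)
open import Function using (_∘_; Equivalence)
open Equivalence using (to; from)
open import Relation.Binary.Definitions using (DecidableEquality)
open import Relation.Binary.PropositionalEquality
open import Relation.Nullary using (¬_; yes; no)
open import Relation.Nullary.Decidable using (⌊_⌋; T?; toWitness; fromWitness)

private
  variable
    A B : Set

¬T⇒T-not : ∀ {b} → ¬ T b → T (not b)
¬T⇒T-not {true}  ¬b = ¬b _
¬T⇒T-not {false} _  = _

count-accept : ∀ (p : A → Bool) {x} xs → T (p x) → count p (x ∷ xs) ≡ suc (count p xs)
count-accept p {x} xs px with p x
... | true = refl

count-reject : ∀ (p : A → Bool) {x} xs → ¬ T (p x) → count p (x ∷ xs) ≡ count p xs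
count-reject p {x} xs ¬px with p x
... | true  = ⊥-elim (¬px _)
... | false = refl

count-mono : ∀ (p q : A → Bool) → (∀ {u} → T (p u) → T (q u)) → ∀ xs →
  count p xs ≤ count q xs
count-mono p q p⇒q [] = z≤n
count-mono p q p⇒q (x ∷ xs) with p x in px | q x in qx
... | true  | true  = s≤s (count-mono p q p⇒q xs)
... | false | true  = m≤n⇒m≤1+n (count-mono p q p⇒q xs)
... | false | false = count-mono p q p⇒q xs
... | true  | false = ⊥-elim (subst T qx (p⇒q (subst T (sym px) _)))

count-cong : ∀ {p q : A → Bool} → p ≗ q → ∀ xs → count p xs ≡ count q xs
count-cong {p = p} {q} p≗q xs =
  ≤-antisym (count-mono p q (subst T (p≗q _)) xs) (count-mono q p (subst T (sym (p≗q _))) xs)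

count-zero : ∀ (p : A → Bool) xs → (∀ {u} → u ∈ xs → ¬ T (p u)) → count p xs ≡ 0
count-zero p []       ¬p = refl
count-zero p (x ∷ xs) ¬p = trans (count-reject p xs (¬p (here refl))) (count-zero p xs (¬p ∘ there))

count-pos⁺ : ∀ (p : A → Bool) {x xs} → x ∈ xs → T (p x) → 0 < count p xs
count-pos⁺ p {xs = y ∷ xs} x∈ px with p y in py | x∈
... | true  | _         = s≤s z≤n
... | false | here refl = ⊥-elim (subst T py px)
... | false | there x∈′ = count-pos⁺ p x∈′ px

count-pos⁻ : ∀ (p : A → Bool) xs → 0 < count p xs → ∃[ x ] x ∈ xs × T (p x)
count-pos⁻ p (x ∷ xs) pos with p x in px
... | true  = x , here refl , subst T (sym px) _
... | false with count-pos⁻ p xs pos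
...   | y , y∈ , py = y , there y∈ , py

count-split : ∀ (p q : A → Bool) xs →
  count p xs ≡ count (λ u → p u ∧ q u) xs + count (λ u → p u ∧ not (q u)) xs
count-split p q [] = refl
count-split p q (x ∷ xs) with p x | q x
... | true  | true  = cong suc (count-split p q xs)
... | true  | false = trans (cong suc (count-split p q xs)) (sym (+-suc _ _))
... | false | _     = count-split p q xs

count-∨-∧ : ∀ (p q : A → Bool) xs →
  count (λ u → p u ∨ q u) xs + count (λ u → p u ∧ q u) xs ≡ count p xs + count q xs
count-∨-∧ p q [] = refl
count-∨-∧ p q (x ∷ xs) with p x | q x
... | true  | true  = cong suc (trans (+-suc _ _) (trans (cong suc (count-∨-∧ p q xs)) (sym (+-suc _ _))))
... | true  | false = cong suc (count-∨-∧ p q xs)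
... | false | true  = trans (cong suc (count-∨-∧ p q xs)) (sym (+-suc _ _))
... | false | false = count-∨-∧ p q xs

count-∨-≤ : ∀ (p q : A → Bool) xs → count (λ u → p u ∨ q u) xs ≤ count p xs + count q xs
count-∨-≤ p q xs = ≤-trans (m≤m+n _ _) (≤-reflexive (count-∨-∧ p q xs))

count-∨-disjoint : ∀ (p q : A → Bool) xs → (∀ {u} → u ∈ xs → T (p u) → T (q u) → ⊥) →
  count (λ u → p u ∨ q u) xs ≡ count p xs + count q xs
count-∨-disjoint {A = A} p q xs disjoint = begin
  count p∨q xs                  ≡⟨ sym (+-identityʳ _) ⟩
  count p∨q xs + 0              ≡⟨ cong (count p∨q xs +_) (sym (count-zero p∧q xs ¬p∧q)) ⟩
  count p∨q xs + count p∧q xs   ≡⟨ count-∨-∧ p q xs ⟩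
  count p xs + count q xs       ∎
  where
  open ≡-Reasoning
  p∨q p∧q : A → Bool
  p∨q u = p u ∨ q u
  p∧q u = p u ∧ q u
  ¬p∧q : ∀ {u} → u ∈ xs → ¬ T (p∧q u)
  ¬p∧q u∈ pq = let pu , qu = to T-∧ pq in disjoint u∈ pu qu

count-< : ∀ (p q : A → Bool) {x xs} → (∀ {u} → T (p u) → T (q u)) →
  x ∈ xs → T (q x) → ¬ T (p x) → count p xs < count q xs
count-< {A = A} p q {xs = xs} p⇒q x∈ qx ¬px = begin-strict
  count p xs
    <⟨ m<m+n _ (count-pos⁺ q∧¬p x∈ (from T-∧ (qx , ¬T⇒T-not ¬px))) ⟩
  count p xs + count q∧¬p xs
    ≤⟨ +-monoˡ-≤ _ (count-mono p q∧p (λ pu → from T-∧ (p⇒q pu , pu)) xs) ⟩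
  count q∧p xs + count q∧¬p xs
    ≡⟨ sym (count-split q p xs) ⟩
  count q xs
    ∎
  where
  open ≤-Reasoning
  q∧p q∧¬p : A → Bool
  q∧p u = q u ∧ p u
  q∧¬p u = q u ∧ not (p u)

count-filterᵇ : ∀ (p q : A → Bool) xs → count p (filterᵇ q xs) ≡ count (λ u → q u ∧ p u) xs
count-filterᵇ p q [] = refl
count-filterᵇ p q (x ∷ xs) with q x
... | false = count-filterᵇ p q xs
... | true with p x
...   | true  = cong suc (count-filterᵇ p q xs)
...   | false = count-filterᵇ p q xs

count-++ : ∀ (p : A → Bool) xs ys → count p (xs ++ ys) ≡ count p xs + count p ys
count-++ p [] ys = refl
count-++ p (x ∷ xs) ys with p x
... | true  = cong suc (count-++ p xs ys)
... | false = count-++ p xs ys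

count-map : ∀ (p : B → Bool) (f : A → B) xs → count p (map f xs) ≡ count (λ u → p (f u)) xs
count-map p f [] = refl
count-map p f (x ∷ xs) with p (f x)
... | true  = cong suc (count-map p f xs)
... | false = count-map p f xs

count-cartesianProduct : ∀ (p : A → Bool) (q : B → Bool) as bs →
  count (λ (a , b) → p a ∧ q b) (cartesianProduct as bs) ≡ count p as * count q bs
count-cartesianProduct p q [] bs = refl
count-cartesianProduct {A = A} {B = B} p q (a ∷ as) bs = begin
  count p×q (map (a ,_) bs ++ cartesianProduct as bs)
    ≡⟨ count-++ p×q (map (a ,_) bs) _ ⟩
  count p×q (map (a ,_) bs) + count p×q (cartesianProduct as bs)
    ≡⟨ cong₂ _+_ (count-map p×q (a ,_) bs) (count-cartesianProduct p q as bs) ⟩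
  count (λ b → p a ∧ q b) bs + count p as * count q bs
    ≡⟨ first-row (p a) refl ⟩
  count p (a ∷ as) * count q bs
    ∎
  where
  open ≡-Reasoning
  p×q : A × B → Bool
  p×q (a , b) = p a ∧ q b
  first-row : ∀ c → p a ≡ c →
    count (λ b → c ∧ q b) bs + count p as * count q bs ≡ count p (a ∷ as) * count q bs
  first-row true  pa = cong (_* count q bs) (sym (count-accept p as (subst T (sym pa) _)))
  first-row false pa = cong₂ (λ z r → z + r * count q bs)
                              (count-zero (λ _ → false) bs (λ _ ()))
                              (sym (count-reject p as (subst T pa)))

count-≤1 : ∀ (p : A → Bool) {xs} → Unique xs →
  (∀ {u v} → u ∈ xs → v ∈ xs → T (p u) → T (p v) → u ≡ v) → count p xs ≤ 1
count-≤1 p [] _ = z≤n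
count-≤1 p {x ∷ xs} (x∉xs ∷ unique) p-injective with p x in px
... | false = count-≤1 p unique (λ u∈ v∈ → p-injective (there u∈) (there v∈))
... | true  = s≤s (≤-reflexive (count-zero p xs only-x))
  where
  only-x : ∀ {u} → u ∈ xs → ¬ T (p u)
  only-x u∈ pu = All.lookup x∉xs u∈ (p-injective (here refl) (there u∈) (subst T (sym px) _) pu)

count-≡1 : ∀ (p : A → Bool) {x xs} → Unique xs → x ∈ xs → T (p x) →
  (∀ {u} → u ∈ xs → T (p u) → u ≡ x) → count p xs ≡ 1
count-≡1 p unique x∈ px only-x =
  ≤-antisym (count-≤1 p unique (λ u∈ v∈ pu pv → trans (only-x u∈ pu) (sym (only-x v∈ pv))))
            (count-pos⁺ p x∈ px)

select : DecidableEquality A → ∀ (p : A → Bool) {xs} → Unique xs → ∀ k → k ≤ count p xs →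
  Σ[ q ∈ (A → Bool) ] (∀ {u} → T (q u) → u ∈ xs × T (p u)) × count q xs ≡ k
select _≟_ p {xs} _ zero _ = (λ _ → false) , (λ ()) , count-zero (λ _ → false) xs (λ _ ())
select {A = A} _≟_ p {x ∷ xs} (x∉xs ∷ unique) (suc k) k<#p with p x in px
... | false =
  let q , q⊆ , #q = select _≟_ p unique (suc k) k<#p
  in q , (λ qu → there (proj₁ (q⊆ qu)) , proj₂ (q⊆ qu))
       , trans (count-reject q xs (λ qx → All.lookup x∉xs (proj₁ (q⊆ qx)) refl)) #q
... | true with select _≟_ p unique k (≤-pred k<#p)
...   | q , q⊆ , #q = x∨q , x∨q⊆ , #x∨q
  where
  ≟x : A → Bool
  ≟x u = ⌊ u ≟ x ⌋
  x∨q : A → Bool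
  x∨q u = ≟x u ∨ q u
  x∉ : ∀ {u} → u ∈ xs → ¬ T (≟x u)
  x∉ u∈ u≡x = All.lookup x∉xs u∈ (sym (toWitness u≡x))
  x∨q⊆ : ∀ {u} → T (x∨q u) → u ∈ x ∷ xs × T (p u)
  x∨q⊆ {u} x∨qu with u ≟ x
  ... | yes refl = here refl , subst T (sym px) _
  ... | no _     = there (proj₁ (q⊆ x∨qu)) , proj₂ (q⊆ x∨qu)
  #x∨q : count x∨q (x ∷ xs) ≡ suc k
  #x∨q = begin
    count x∨q (x ∷ xs)
      ≡⟨ count-accept x∨q xs (from (T-∨ {≟x x}) (inj₁ (fromWitness {a? = x ≟ x} refl))) ⟩
    suc (count x∨q xs)
      ≡⟨ cong suc (count-∨-disjoint ≟x q xs (λ u∈ u≡x _ → x∉ u∈ u≡x)) ⟩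
    suc (count ≟x xs + count q xs)
      ≡⟨ cong suc (cong₂ _+_ (count-zero ≟x xs x∉) #q) ⟩
    suc k
      ∎
    where open ≡-Reasoning

n≤⌈n/2⌉+⌈n/2⌉ : ∀ n → n ≤ ⌈ n /2⌉ + ⌈ n /2⌉
n≤⌈n/2⌉+⌈n/2⌉ n = begin
  n                      ≡⟨ sym (⌊n/2⌋+⌈n/2⌉≡n n) ⟩
  ⌊ n /2⌋ + ⌈ n /2⌉     ≤⟨ +-monoˡ-≤ _ (⌊n/2⌋≤⌈n/2⌉ n) ⟩
  ⌈ n /2⌉ + ⌈ n /2⌉     ∎
  where open ≤-Reasoning

n≤m+m⇒⌈n/2⌉≤m : ∀ {n m} → n ≤ m + m → ⌈ n /2⌉ ≤ m
n≤m+m⇒⌈n/2⌉≤m {m = m} n≤m+m =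
  ≤-trans (⌈n/2⌉-mono n≤m+m) (≤-reflexive (sym (n≡⌈n+n/2⌉ m)))

module _ {V : Set} (verts : List V) (adj : V → V → Bool) where
  open Alliance verts adj

  -- Defensive (-t)-alliances; for t = 1 and t = 0 this is definitionally IsDefensiveAlliance and
  -- IsStrongDefensiveAlliance.
  IsAllianceWithSlack : ℕ → (V → Bool) → Set
  IsAllianceWithSlack t S =
    NonemptySubset S × (∀ v → v ∈ verts → T (S v) → degOut S v ≤ t + degIn S v)

  IsClique : (V → Bool) → Set
  IsClique S = ∀ {u v} → T (S u) → T (S v) → u ≢ v → T (adj u v)

  IsRegular : ℕ → Set
  IsRegular d = ∀ v → v ∈ verts → count (adj v) verts ≡ d

  degIn<card : ∀ {S v} → adj v v ≡ false → v ∈ verts → T (S v) → degIn S v < card S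
  degIn<card {S} {v} irrefl v∈ Sv =
    count-< (λ u → adj v u ∧ S u) S (proj₂ ∘ to T-∧) v∈ Sv
            (λ adj∧S → subst T irrefl (proj₁ (to T-∧ adj∧S)))

  card≤1+degIn : DecidableEquality V → Unique verts → ∀ {S v} → IsClique S → T (S v) →
    card S ≤ suc (degIn S v)
  card≤1+degIn _≟_ unique {S} {v} clique Sv = begin
    count S verts                        ≤⟨ count-mono S (λ u → adj∧S u ∨ ≟v u) adjacent-or-v verts ⟩
    count (λ u → adj∧S u ∨ ≟v u) verts   ≤⟨ count-∨-≤ adj∧S ≟v verts ⟩
    degIn S v + count ≟v verts           ≤⟨ +-monoʳ-≤ _ (count-≤1 ≟v unique ≟v-injective) ⟩
    degIn S v + 1                        ≡⟨ +-comm _ 1 ⟩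
    suc (degIn S v)                      ∎
    where
    open ≤-Reasoning
    adj∧S ≟v : V → Bool
    adj∧S u = adj v u ∧ S u
    ≟v u = ⌊ u ≟ v ⌋
    ≟v-injective : ∀ {u w} → u ∈ verts → w ∈ verts → T (≟v u) → T (≟v w) → u ≡ w
    ≟v-injective _ _ u≡v w≡v = trans (toWitness u≡v) (sym (toWitness w≡v))
    adjacent-or-v : ∀ {u} → T (S u) → T (adj∧S u ∨ ≟v u)
    adjacent-or-v {u} Su with u ≟ v
    ... | yes _   = from (T-∨ {adj∧S u}) (inj₂ _)
    ... | no  u≢v = from T-∨ (inj₁ (from T-∧ (clique Sv Su (u≢v ∘ sym) , Su)))

  module _ {d : ℕ} (regular : IsRegular d) where

    private
      slack-identity : ∀ t i → t + (suc i + suc i) ≡ suc (suc (i + (t + i)))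
      slack-identity = solve-∀

    degIn+degOut≡d : ∀ S {v} → v ∈ verts → degIn S v + degOut S v ≡ d
    degIn+degOut≡d S {v} v∈ = trans (sym (count-split (adj v) S verts)) (regular v v∈)

    alliance⇒d+2≤t+2card : (∀ v → adj v v ≡ false) → ∀ {t S} → IsAllianceWithSlack t S →
      suc (suc d) ≤ t + (card S + card S)
    alliance⇒d+2≤t+2card irrefl {t} {S} ((_ , v , v∈ , Sv) , defended) = begin
      suc (suc d)               ≡⟨ cong (suc ∘ suc) (sym (degIn+degOut≡d S v∈)) ⟩
      suc (suc (i + o))         ≤⟨ s≤s (s≤s (+-monoʳ-≤ i (defended v v∈ Sv))) ⟩
      suc (suc (i + (t + i)))   ≡⟨ sym (slack-identity t i) ⟩
      t + (suc i + suc i)       ≤⟨ +-monoʳ-≤ t (+-mono-≤ i<card i<card) ⟩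
      t + (card S + card S)     ∎
      where
      open ≤-Reasoning
      i o : ℕ
      i = degIn S v
      o = degOut S v
      i<card : i < card S
      i<card = degIn<card (irrefl v) v∈ Sv

    clique⇒alliance : DecidableEquality V → Unique verts → ∀ {t S} →
      IsClique S → NonemptySubset S → suc (suc d) ≤ t + (card S + card S) → IsAllianceWithSlack t S
    clique⇒alliance _≟_ unique {t} {S} clique nonempty d+2≤ = nonempty , defended
      where
      defended : ∀ v → v ∈ verts → T (S v) → degOut S v ≤ t + degIn S v
      defended v v∈ Sv = +-cancelˡ-≤ i o (t + i) (≤-pred (≤-pred (begin
        suc (suc (i + o))         ≡⟨ cong (suc ∘ suc) (degIn+degOut≡d S v∈) ⟩
        suc (suc d)               ≤⟨ d+2≤ ⟩
        t + (card S + card S)     ≤⟨ +-monoʳ-≤ t (+-mono-≤ card≤ card≤) ⟩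
        t + (suc i + suc i)       ≡⟨ slack-identity t i ⟩
        suc (suc (i + (t + i)))   ∎)))
        where
        open ≤-Reasoning
        i o : ℕ
        i = degIn S v
        o = degOut S v
        card≤ : card S ≤ suc i
        card≤ = card≤1+degIn _≟_ unique clique Sv

    -- m = d + 2 - t, stated without truncated subtraction.
    allianceNumber≡⌈/2⌉ : (∀ v → adj v v ≡ false) → DecidableEquality V → Unique verts →
      ∀ t m → m + t ≡ suc (suc d) →
      (Σ[ S ∈ (V → Bool) ] NonemptySubset S × IsClique S × card S ≡ ⌈ m /2⌉) →
      IsMinCard (IsAllianceWithSlack t) ⌈ m /2⌉
    allianceNumber≡⌈/2⌉ irrefl _≟_ unique t m m+t≡ (S , nonempty , clique , #S) =
      (S , clique⇒alliance _≟_ unique clique nonempty d+2≤ , #S) , minimal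
      where
      open ≤-Reasoning
      d+2≤ : suc (suc d) ≤ t + (card S + card S)
      d+2≤ = begin
        suc (suc d)               ≡⟨ sym m+t≡ ⟩
        m + t                     ≤⟨ +-monoˡ-≤ t (n≤⌈n/2⌉+⌈n/2⌉ m) ⟩
        ⌈ m /2⌉ + ⌈ m /2⌉ + t     ≡⟨ +-comm _ t ⟩
        t + (⌈ m /2⌉ + ⌈ m /2⌉)   ≡⟨ cong (λ c → t + (c + c)) (sym #S) ⟩
        t + (card S + card S)     ∎
      minimal : ∀ S′ → IsAllianceWithSlack t S′ → ⌈ m /2⌉ ≤ card S′
      minimal S′ alliance = n≤m+m⇒⌈n/2⌉≤m (+-cancelʳ-≤ t m _ (begin
        m + t                     ≡⟨ m+t≡ ⟩
        suc (suc d)               ≤⟨ alliance⇒d+2≤t+2card irrefl alliance ⟩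
        t + (card S′ + card S′)   ≡⟨ +-comm t _ ⟩
        card S′ + card S′ + t     ∎))

module LineGraph {n : ℕ} (G : SimpleGraph n) where
  open SimpleGraph G
  open Alliance (lineVerts G) (lineAdj G)

  Edge : Set
  Edge = Fin n × Fin n

  isEdge : Edge → Bool
  isEdge (k , l) = ⌊ k <? l ⌋ ∧ adj k l

  allPairs : List Edge
  allPairs = cartesianProduct (allFin n) (allFin n)

  edges : List Edge
  edges = lineVerts G

  edges-unique : Unique edges
  edges-unique = filter⁺ (T? ∘ isEdge) (cartesianProduct⁺ (allFin⁺ n) (allFin⁺ n))

  isEdge⁻ : ∀ {k l} → T (isEdge (k , l)) → k F.< l × T (adj k l)
  isEdge⁻ {k} {l} kl with to (T-∧ {⌊ k <? l ⌋}) kl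
  ... | k<l , adj-kl = toWitness k<l , adj-kl

  ∈edges⁻ : ∀ {k l} → (k , l) ∈ edges → k F.< l × T (adj k l)
  ∈edges⁻ kl∈ = isEdge⁻ (proj₂ (∈-filter⁻ (T? ∘ isEdge) {xs = allPairs} kl∈))

  incident : Fin n → Edge → Bool
  incident x (k , l) = ⌊ x ≟ k ⌋ ∨ ⌊ x ≟ l ⌋

  sameEdge : Edge → Edge → Bool
  sameEdge (i , j) (k , l) = ⌊ i ≟ k ⌋ ∧ ⌊ j ≟ l ⌋

  incident⁻ : ∀ {x k l} → T (incident x (k , l)) → x ≡ k ⊎ x ≡ l
  incident⁻ {x} {k} x∈kl with to (T-∨ {⌊ x ≟ k ⌋}) x∈kl
  ... | inj₁ x≡k = inj₁ (toWitness x≡k)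
  ... | inj₂ x≡l = inj₂ (toWitness x≡l)

  sameEdge⁻ : ∀ {u v} → T (sameEdge u v) → u ≡ v
  sameEdge⁻ {i , j} same with to (T-∧ {⌊ i ≟ _ ⌋}) same
  ... | i≡k , j≡l = cong₂ _,_ (toWitness i≡k) (toWitness j≡l)

  lineAdj≗ : ∀ i j →
    lineAdj G (i , j) ≗ λ u → not (sameEdge (i , j) u) ∧ (incident i u ∨ incident j u)
  lineAdj≗ i j (k , l) =
    cong (not (sameEdge (i , j) (k , l)) ∧_) (sym (∨-assoc ⌊ i ≟ k ⌋ ⌊ i ≟ l ⌋ _))

  lineAdj-irrefl : ∀ e → lineAdj G e e ≡ false
  lineAdj-irrefl (i , j) with i ≟ i | j ≟ j
  ... | yes _  | yes _  = refl
  ... | no i≢i | _      = ⊥-elim (i≢i refl)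
  ... | yes _  | no j≢j = ⊥-elim (j≢j refl)

  count-≟ : ∀ x → count (λ y → ⌊ x ≟ y ⌋) (allFin n) ≡ 1
  count-≟ x = count-≡1 (λ y → ⌊ x ≟ y ⌋) (allFin⁺ n) (∈-allFin x) (fromWitness {a? = x ≟ x} refl)
                       (λ _ x≡y → sym (toWitness x≡y))

  ∧-≟-subst : ∀ (f : Fin n → Bool) x y → f y ∧ ⌊ x ≟ y ⌋ ≡ f x ∧ ⌊ x ≟ y ⌋
  ∧-≟-subst f x y with x ≟ y
  ... | yes refl = refl
  ... | no _     = trans (∧-zeroʳ (f y)) (sym (∧-zeroʳ (f x)))

  count-smallerEnd : ∀ x →
    count (λ (k , _) → ⌊ x ≟ k ⌋) edges ≡ count (λ l → isEdge (x , l)) (allFin n)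
  count-smallerEnd x = begin
    count (λ (k , _) → ⌊ x ≟ k ⌋) edges
      ≡⟨ count-filterᵇ _ isEdge allPairs ⟩
    count (λ (k , l) → isEdge (k , l) ∧ ⌊ x ≟ k ⌋) allPairs
      ≡⟨ count-cong (λ (k , l) → trans (∧-≟-subst (λ k → isEdge (k , l)) x k)
                                        (∧-comm (isEdge (x , l)) _)) allPairs ⟩
    count (λ (k , l) → ⌊ x ≟ k ⌋ ∧ isEdge (x , l)) allPairs
      ≡⟨ count-cartesianProduct _ _ (allFin n) (allFin n) ⟩
    count (λ k → ⌊ x ≟ k ⌋) (allFin n) * count (λ l → isEdge (x , l)) (allFin n)
      ≡⟨ cong (_* count (λ l → isEdge (x , l)) (allFin n)) (count-≟ x) ⟩
    1 * count (λ l → isEdge (x , l)) (allFin n)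
      ≡⟨ *-identityˡ _ ⟩
    count (λ l → isEdge (x , l)) (allFin n)
      ∎
    where open ≡-Reasoning

  count-largerEnd : ∀ x →
    count (λ (_ , l) → ⌊ x ≟ l ⌋) edges ≡ count (λ k → isEdge (k , x)) (allFin n)
  count-largerEnd x = begin
    count (λ (_ , l) → ⌊ x ≟ l ⌋) edges
      ≡⟨ count-filterᵇ _ isEdge allPairs ⟩
    count (λ (k , l) → isEdge (k , l) ∧ ⌊ x ≟ l ⌋) allPairs
      ≡⟨ count-cong (λ (k , l) → ∧-≟-subst (λ l → isEdge (k , l)) x l) allPairs ⟩
    count (λ (k , l) → isEdge (k , x) ∧ ⌊ x ≟ l ⌋) allPairs
      ≡⟨ count-cartesianProduct _ _ (allFin n) (allFin n) ⟩
    count (λ k → isEdge (k , x)) (allFin n) * count (λ l → ⌊ x ≟ l ⌋) (allFin n)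
      ≡⟨ cong (count (λ k → isEdge (k , x)) (allFin n) *_) (count-≟ x) ⟩
    count (λ k → isEdge (k , x)) (allFin n) * 1
      ≡⟨ *-identityʳ _ ⟩
    count (λ k → isEdge (k , x)) (allFin n)
      ∎
    where open ≡-Reasoning

  isEdge-either-way : ∀ x y → isEdge (x , y) ∨ isEdge (y , x) ≡ adj x y
  isEdge-either-way x y with x <? y | y <? x
  ... | yes x<y | yes y<x = ⊥-elim (FP.<-asym x<y y<x)
  ... | yes _   | no _    = ∨-identityʳ (adj x y)
  ... | no _    | yes _   = symm y x
  ... | no x≮y  | no y≮x  rewrite FP.≤-antisym (≮⇒≥ y≮x) (≮⇒≥ x≮y) = sym (irrefl y)

  count-incident : ∀ x → count (incident x) edges ≡ degree G x
  count-incident x = begin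
    count (incident x) edges
      ≡⟨ count-∨-disjoint smallerEnd largerEnd edges no-loop ⟩
    count smallerEnd edges + count largerEnd edges
      ≡⟨ cong₂ _+_ (count-smallerEnd x) (count-largerEnd x) ⟩
    count (λ y → isEdge (x , y)) (allFin n) + count (λ y → isEdge (y , x)) (allFin n)
      ≡⟨ sym (count-∨-disjoint _ _ (allFin n) λ _ xy yx → FP.<-asym (proj₁ (isEdge⁻ xy))
                                                                     (proj₁ (isEdge⁻ yx))) ⟩
    count (λ y → isEdge (x , y) ∨ isEdge (y , x)) (allFin n)
      ≡⟨ count-cong (isEdge-either-way x) (allFin n) ⟩
    degree G x
      ∎
    where
    open ≡-Reasoning
    smallerEnd largerEnd : Edge → Bool
    smallerEnd (k , _) = ⌊ x ≟ k ⌋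
    largerEnd  (_ , l) = ⌊ x ≟ l ⌋
    no-loop : ∀ {u} → u ∈ edges → T (smallerEnd u) → T (largerEnd u) → ⊥
    no-loop {k , l} u∈ x≡k x≡l =
      FP.<-irrefl (trans (sym (toWitness x≡k)) (toWitness x≡l)) (proj₁ (∈edges⁻ u∈))

  count-sameEdge : ∀ {e} → e ∈ edges → count (sameEdge e) edges ≡ 1
  count-sameEdge {i , j} e∈ =
    count-≡1 (sameEdge (i , j)) edges-unique e∈
             (from T-∧ (fromWitness {a? = i ≟ i} refl , fromWitness {a? = j ≟ j} refl))
             (λ _ same → sym (sameEdge⁻ same))

  count-incident-both : ∀ {i j} → (i , j) ∈ edges →
    count (λ u → incident i u ∧ incident j u) edges ≡ 1
  count-incident-both {i} {j} e∈ = count-≡1 _ edges-unique e∈ ends only-e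
    where
    i<j : i F.< j
    i<j = proj₁ (∈edges⁻ e∈)
    ends : T (incident i (i , j) ∧ incident j (i , j))
    ends = from T-∧ ( from (T-∨ {⌊ i ≟ i ⌋}) (inj₁ (fromWitness {a? = i ≟ i} refl))
                                , from (T-∨ {⌊ j ≟ i ⌋}) (inj₂ (fromWitness {a? = j ≟ j} refl)))
    only-e : ∀ {u} → u ∈ edges → T (incident i u ∧ incident j u) → u ≡ (i , j)
    only-e {k , l} u∈ both with to (T-∧ {incident i (k , l)}) both
    ... | i∈ , j∈ with incident⁻ {i} i∈ | incident⁻ {j} j∈
    ... | inj₁ refl | inj₂ refl = refl
    ... | inj₁ refl | inj₁ refl = ⊥-elim (FP.<-irrefl refl i<j)
    ... | inj₂ refl | inj₂ refl = ⊥-elim (FP.<-irrefl refl i<j)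
    ... | inj₂ refl | inj₁ refl = ⊥-elim (FP.<-asym i<j (proj₁ (∈edges⁻ u∈)))

  count-incident-either : ∀ {i j} → (i , j) ∈ edges →
    count (λ u → incident i u ∨ incident j u) edges ≡ suc (count (lineAdj G (i , j)) edges)
  count-incident-either {i} {j} e∈ = begin
    count X edges
      ≡⟨ count-split X same edges ⟩
    count (λ u → X u ∧ same u) edges + count (λ u → X u ∧ not (same u)) edges
      ≡⟨ cong₂ _+_ (count-cong X∧same edges) (count-cong X∧¬same edges) ⟩
    count same edges + count (lineAdj G (i , j)) edges
      ≡⟨ cong (_+ count (lineAdj G (i , j)) edges) (count-sameEdge e∈) ⟩
    suc (count (lineAdj G (i , j)) edges)
      ∎
    where
    open ≡-Reasoning
    X same : Edge → Bool
    X u = incident i u ∨ incident j u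
    same = sameEdge (i , j)
    X∧same : ∀ u → X u ∧ same u ≡ same u
    X∧same (k , l) with i ≟ k
    ... | yes _ = refl
    ... | no _  = ∧-zeroʳ _
    X∧¬same : ∀ u → X u ∧ not (same u) ≡ lineAdj G (i , j) u
    X∧¬same u = trans (∧-comm (X u) _) (sym (lineAdj≗ i j u))

  line-degree : ∀ {i j} → (i , j) ∈ edges →
    count (lineAdj G (i , j)) edges + 2 ≡ degree G i + degree G j
  line-degree {i} {j} e∈ = begin
    count (lineAdj G (i , j)) edges + 2
      ≡⟨ +-suc _ 1 ⟩
    suc (count (lineAdj G (i , j)) edges) + 1
      ≡⟨ cong₂ _+_ (sym (count-incident-either e∈)) (sym (count-incident-both e∈)) ⟩
    count (λ u → incident i u ∨ incident j u) edges
      + count (λ u → incident i u ∧ incident j u) edges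
      ≡⟨ count-∨-∧ (incident i) (incident j) edges ⟩
    count (incident i) edges + count (incident j) edges
      ≡⟨ cong₂ _+_ (count-incident i) (count-incident j) ⟩
    degree G i + degree G j
      ∎
    where open ≡-Reasoning

  incident-adjacent : ∀ {x u v} → T (incident x u) → T (incident x v) → u ≢ v → T (lineAdj G u v)
  incident-adjacent {x} {i , j} {v} xu xv u≢v =
    subst T (sym (lineAdj≗ i j v)) (from T-∧ (¬T⇒T-not (u≢v ∘ sameEdge⁻) , shared))
    where
    shared : T (incident i v ∨ incident j v)
    shared with incident⁻ {x} xu
    ... | inj₁ refl = from T-∨ (inj₁ xv)
    ... | inj₂ refl = from (T-∨ {incident i v}) (inj₂ xv)

  star-clique : ∀ x {k} → 0 < k → k ≤ degree G x →
    Σ[ S ∈ (Edge → Bool) ] NonemptySubset S × IsClique edges (lineAdj G) S × card S ≡ k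
  star-clique x {k} 0<k k≤deg
    with select (≡-dec _≟_ _≟_) (incident x) edges-unique k
                (subst (k ≤_) (sym (count-incident x)) k≤deg)
  ... | S , S⊆ , #S = S , ((λ _ → proj₁ ∘ S⊆) , nonempty) , clique , #S
    where
    nonempty : ∃[ e ] e ∈ edges × T (S e)
    nonempty = count-pos⁻ S edges (subst (0 <_) (sym #S) 0<k)
    clique : IsClique edges (lineAdj G) S
    clique Su Sv = incident-adjacent {x} (proj₂ (S⊆ Su)) (proj₂ (S⊆ Sv))

module SemiregularBipartite {n : ℕ} {Γ : SimpleGraph n} {δ₁ δ₂ : ℕ}
                            (semiregular : IsSemiregularBipartite Γ δ₁ δ₂) where
  open SimpleGraph Γ
  open IsSemiregularBipartite semiregular
  open LineGraph Γ

  degree-sum : ∀ {i j} → T (adj i j) → degree Γ i + degree Γ j ≡ δ₁ + δ₂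
  degree-sum {i} {j} ij with side i in si | side j in sj
  ... | false | true  = cong₂ _+_ (degX i si) (degY j sj)
  ... | true  | false = trans (cong₂ _+_ (degY i si) (degX j sj)) (+-comm δ₂ δ₁)
  ... | false | false = ⊥-elim (bipartite i j ij (trans si (sym sj)))
  ... | true  | true  = ⊥-elim (bipartite i j ij (trans si (sym sj)))

  line-regular : ∀ {e} → e ∈ edges → count (lineAdj Γ e) edges + 2 ≡ δ₁ + δ₂
  line-regular e∈ = trans (line-degree e∈) (degree-sum (proj₂ (∈edges⁻ e∈)))

  vertex-of-large-degree : 0 < δ₁ → 0 < δ₂ → Fin n →
    Σ[ x ∈ Fin n ] δ₁ + δ₂ ≤ degree Γ x + degree Γ x
  vertex-of-large-degree 0<δ₁ 0<δ₂ v with count-pos⁻ (adj v) (allFin n) 0<deg-v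
    where
    0<deg-v : 0 < degree Γ v
    0<deg-v with side v in sv
    ... | false = subst (0 <_) (sym (degX v sv)) 0<δ₁
    ... | true  = subst (0 <_) (sym (degY v sv)) 0<δ₂
  ... | w , _ , vw with ≤-total (degree Γ v) (degree Γ w)
  ... | inj₁ v≤w = w , ≤-trans (≤-reflexive (sym (degree-sum vw))) (+-monoˡ-≤ (degree Γ w) v≤w)
  ... | inj₂ w≤v = v , ≤-trans (≤-reflexive (sym (degree-sum vw))) (+-monoʳ-≤ (degree Γ v) w≤v)

mainTheorem3 : ∀ {n : ℕ} (Γ : SimpleGraph n) (δ₁ δ₂ : ℕ)
    → IsSemiregularBipartite Γ δ₁ δ₂
    → δ₁ ≥ 1 → δ₂ ≥ 1 → Fin n
    → Alliance.AllianceNumber≡ (lineVerts Γ) (lineAdj Γ) ⌈ (δ₁ + δ₂ ∸ 1) /2⌉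
    × Alliance.StrongAllianceNumber≡ (lineVerts Γ) (lineAdj Γ) ⌈ (δ₁ + δ₂) /2⌉
mainTheorem3 {n} Γ (suc a) (suc b) semiregular 0<δ₁ 0<δ₂ v =
  allianceNumber 1 (a + suc b) (+-comm (a + suc b) 1) (subst (0 <_) (sym (+-suc a b)) (s≤s z≤n)) ,
  allianceNumber 0 (suc a + suc b) (+-identityʳ _) (s≤s z≤n)
  where
  open LineGraph Γ
  open SemiregularBipartite semiregular
  δ₁+δ₂≡d+2 : suc a + suc b ≡ suc (suc (a + b))
  δ₁+δ₂≡d+2 = cong suc (+-suc a b)
  regular : IsRegular edges (lineAdj Γ) (a + b)
  regular e e∈ = +-cancelʳ-≡ 2 _ _ (trans (line-regular e∈) (trans δ₁+δ₂≡d+2 (+-comm 2 (a + b))))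
  hub : Σ[ x ∈ Fin n ] suc a + suc b ≤ degree Γ x + degree Γ x
  hub = vertex-of-large-degree 0<δ₁ 0<δ₂ v
  allianceNumber : ∀ t m → m + t ≡ suc a + suc b → 0 < m →
    Alliance.IsMinCard edges (lineAdj Γ) (IsAllianceWithSlack edges (lineAdj Γ) t) ⌈ m /2⌉
  allianceNumber t m m+t≡ 0<m =
    allianceNumber≡⌈/2⌉ edges (lineAdj Γ) regular lineAdj-irrefl (≡-dec _≟_ _≟_) edges-unique
      t m (trans m+t≡ δ₁+δ₂≡d+2)
      (star-clique (proj₁ hub) (⌈n/2⌉-mono 0<m) (n≤m+m⇒⌈n/2⌉≤m m≤2deg))
    where
    m≤2deg : m ≤ degree Γ (proj₁ hub) + degree Γ (proj₁ hub)
    m≤2deg = ≤-trans (m≤m+n m t) (≤-trans (≤-reflexive m+t≡) (proj₂ hub))
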